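{- Let $k\geq 1$ and $n>2k+1$ be integers. Then the generalised Mycielskian $M_k(SG(n-1,k))$ admits a graph homomorphism to the Schrijver graph $SG(n,k)$.
   Context: The Schrijver graph $SG(m,k)$ ($m>2k$) has as vertices the $k$-element subsets of $[m]=\{1,\dots,m\}$ containing no two cyclically consecutive elements (i.e. independent in the cycle with edges $12,\dots,(m-1)m,m1$), two vertices adjacent iff the sets are disjoint. For a graph $G$ with vertex set $V$ and $r\geq 1$, the generalised Mycielskian $M_r(G)$ has vertex set $\{z\}\cup(V\times[r])$; for $i=2,\dots,r$ and each edge $vw$ of $G$, $(v,i)$ and $(w,i-1)$ are adjacent; $V\times\{r\}$ induces a copy of $G$; $z$ is adjacent to every vertex of $V\times\{1\}$; there are no other edges. A homomorphism $G\to H$ is a map $f:V(G)\to V(H)$ with $f(u)f(v)\in E(H)$ whenever $uv\in E(G)$. -}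

module Defs where

open import Level using (Level; _⊔_)
open import Data.Nat using (ℕ; zero; suc; _∸_; _+_; _*_)
open import Data.Fin using (Fin; toℕ)
open import Data.Fin.Subset using (Subset; _∈_; ∣_∣; Empty; _∩_)
open import Data.Product using (Σ; _×_; proj₁)
open import Data.Sum using (_⊎_)
open import Relation.Binary.PropositionalEquality using (_≡_)
open import Relation.Nullary using (¬_)

record Graph (a b : Level) : Set (Level.suc (a ⊔ b)) where
  field
    V   : Set a
    Adj : V → V → Set b
open Graph public

Hom : ∀ {a b c d} → Graph a b → Graph c d → Set (a ⊔ b ⊔ c ⊔ d)
Hom G H = Σ (V G → V H) λ f → ∀ u v → Adj G u v → Adj H (f u) (f v)

-- i and j are cyclically consecutive in the cycle 1,2,...,m,1
-- (elements of [m] are represented by Fin m, with toℕ i + 1 being the element)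
CycConsec : (m : ℕ) → Fin m → Fin m → Set
CycConsec m i j = (toℕ j ≡ suc (toℕ i)) ⊎ ((toℕ i ≡ m ∸ 1) × (toℕ j ≡ 0))

CycStable : (m : ℕ) → Subset m → Set
CycStable m S = ∀ i j → CycConsec m i j → ¬ (i ∈ S × j ∈ S)

SGVertex : ℕ → ℕ → Set
SGVertex m k = Σ (Subset m) λ S → (∣ S ∣ ≡ k) × CycStable m S

SG : ℕ → ℕ → Graph Level.zero Level.zero
SG m k = record
  { V   = SGVertex m k
  ; Adj = λ S T → Empty (proj₁ S ∩ proj₁ T) }

-- vertices of the generalised Mycielskian M_r(G); layer v i stands for
-- (v, toℕ i + 1), i.e. levels 1..r are Fin r with level 1 = zero
data MVert {a} (A : Set a) (r : ℕ) : Set a where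
  apex  : MVert A r
  layer : A → Fin r → MVert A r

data MAdj {a b} (G : Graph a b) (r : ℕ) : MVert (V G) r → MVert (V G) r → Set (a ⊔ b) where
  up    : ∀ v w (i j : Fin r) → Adj G v w → toℕ i ≡ suc (toℕ j) → MAdj G r (layer v i) (layer w j)
  down  : ∀ v w (i j : Fin r) → Adj G v w → toℕ j ≡ suc (toℕ i) → MAdj G r (layer v i) (layer w j)
  top   : ∀ v w (i j : Fin r) → Adj G v w → toℕ i ≡ r ∸ 1 → toℕ j ≡ r ∸ 1 → MAdj G r (layer v i) (layer w j)
  apexˡ : ∀ v (i : Fin r) → toℕ i ≡ 0 → MAdj G r apex (layer v i)
  apexʳ : ∀ v (i : Fin r) → toℕ i ≡ 0 → MAdj G r (layer v i) apex

Myc : ∀ {a b} → ℕ → Graph a b → Graph a (a ⊔ b)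
Myc r G = record { V = MVert (V G) r ; Adj = MAdj G r }

-- Positions are 0-based: SG(m, k) lives on [0, m) and SG(m + 1, k) on [0, m]. A vertex (S, i) of
-- the Mycielskian is sent to the i smallest elements of S ∩ [j, m - j) together with border j, where
-- j = k - i is its depth, and the apex is sent to border k. The sets border j are stable j-subsets
-- of the (m+1)-cycle at its two ends, and border j and border (j + 1) are disjoint. Since a stable
-- k-set of the m-cycle meets the 2j consecutive positions outside [j, m - j) in at most j points,
-- S ∩ [j, m - j) has at least i elements. Mycielskian edges join consecutive depths (or two
-- vertices of depth 0), and the windows keep the parts taken from S away from the borders, which
-- gives disjointness.
module Submission where

open import Defs
open import Data.Nat.Base
  using (ℕ; zero; suc; pred; _+_; _*_; _∸_; _⊓_; _≤_; _<_; z≤n; s≤s; _≤ᵇ_; _<ᵇ_; _≡ᵇ_)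
open import Data.Nat.Properties
open import Algebra.Properties.CommutativeSemigroup +-commutativeSemigroup
  using (interchange; xy∙z≈y∙zx; xy∙z≈x∙zy)
open import Data.Bool.Base using (Bool; true; false; T; _∧_; _∨_)
open import Data.Bool.Properties using (T-∧)
open import Data.Empty using (⊥)
open import Data.Product using (Σ; _×_; _,_; proj₁; proj₂)
open import Data.Sum using (_⊎_; inj₁; inj₂; map₁)
open import Data.Fin.Base using (Fin; toℕ) renaming (zero to fzero; suc to fsuc)
open import Data.Fin.Properties using (toℕ-injective; toℕ<n)
open import Data.Fin.Subset using (Subset; _∈_; ∣_∣; Empty; _∩_)
open import Data.Fin.Subset.Properties using (x∈p∩q⁺; x∈p∩q⁻)
open import Data.Vec.Base using ([]; _∷_; tabulate; here; there)
open import Data.Vec.Properties using (lookup∘tabulate; []=⇒lookup)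
open import Function.Base using (_∘_)
open import Function.Bundles using (module Equivalence)
open import Relation.Binary.PropositionalEquality

BPred : Set
BPred = ℕ → Bool

∅ᵇ : BPred
∅ᵇ _ = false

_∪ᵇ_ _∩ᵇ_ : BPred → BPred → BPred
(F ∪ᵇ G) v = F v ∨ G v
(F ∩ᵇ G) v = F v ∧ G v

_⊆ᵇ_ : BPred → BPred → Set
F ⊆ᵇ G = ∀ {v} → T (F v) → T (G v)

∩ᵇ-⊆ˡ : ∀ F G → (F ∩ᵇ G) ⊆ᵇ F
∩ᵇ-⊆ˡ F G {v} = proj₁ ∘ Equivalence.to (T-∧ {F v})

∩ᵇ-⊆ʳ : ∀ F G → (F ∩ᵇ G) ⊆ᵇ G
∩ᵇ-⊆ʳ F G {v} = proj₂ ∘ Equivalence.to (T-∧ {F v})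

Disjoint : ℕ → BPred → BPred → Set
Disjoint L F G = ∀ {v} → v < L → T (F v) → T (G v) → ⊥

PathStable : ℕ → BPred → Set
PathStable L F = ∀ {v} → suc v < L → T (F v) → T (F (suc v)) → ⊥

CycleStable : ℕ → BPred → Set
CycleStable L F = PathStable L F × (∀ {w} → suc w ≡ L → T (F w) → T (F 0) → ⊥)

T-∨⁻ : ∀ a {b} → T (a ∨ b) → T a ⊎ T b
T-∨⁻ true  _ = inj₁ _
T-∨⁻ false t = inj₂ t

Disjoint-sym : ∀ {L F G} → Disjoint L F G → Disjoint L G F
Disjoint-sym F∩G=∅ v<L Gv Fv = F∩G=∅ v<L Fv Gv

Disjoint-mono : ∀ {L F F′ G G′} → F′ ⊆ᵇ F → G′ ⊆ᵇ G → Disjoint L F G → Disjoint L F′ G′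
Disjoint-mono F′⊆F G′⊆G F∩G=∅ v<L F′v G′v = F∩G=∅ v<L (F′⊆F F′v) (G′⊆G G′v)

bit : Bool → ℕ
bit true  = 1
bit false = 0

count : BPred → ℕ → ℕ
count F zero    = 0
count F (suc L) = bit (F 0) + count (F ∘ suc) L

bit-mono : ∀ {a b} → (T a → T b) → bit a ≤ bit b
bit-mono {false} _   = z≤n
bit-mono {true} {true}  _   = ≤-refl
bit-mono {true} {false} a⇒b with () ← a⇒b _

bit-∨ : ∀ a b → (T a → T b → ⊥) → bit (a ∨ b) ≡ bit a + bit b
bit-∨ true  true  a∩b=∅ with () ← a∩b=∅ _ _
bit-∨ true  false _ = refl
bit-∨ false b     _ = refl

count-false : ∀ L → count ∅ᵇ L ≡ 0
count-false zero    = refl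
count-false (suc L) = count-false L

count-mono : ∀ L {F G} → (∀ {v} → v < L → T (F v) → T (G v)) → count F L ≤ count G L
count-mono zero    _   = z≤n
count-mono (suc L) F⊆G =
  +-mono-≤ (bit-mono (F⊆G (s≤s z≤n))) (count-mono L (λ v<L → F⊆G (s≤s v<L)))

count-mono-length : ∀ {a L} F → a ≤ L → count F a ≤ count F L
count-mono-length F z≤n      = z≤n
count-mono-length F (s≤s a≤L) = +-monoʳ-≤ (bit (F 0)) (count-mono-length (F ∘ suc) a≤L)

count-+ : ∀ a b F → count F (a + b) ≡ count F a + count (λ v → F (a + v)) b
count-+ zero    b F = refl
count-+ (suc a) b F =
  trans (cong (bit (F 0) +_) (count-+ a b (F ∘ suc))) (sym (+-assoc (bit (F 0)) _ _))

count-snoc : ∀ L F → count F (suc L) ≡ count F L + bit (F L)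
count-snoc zero    F = +-comm (bit (F 0)) 0
count-snoc (suc L) F =
  trans (cong (bit (F 0) +_) (count-snoc L (F ∘ suc))) (sym (+-assoc (bit (F 0)) _ _))

count-reverse : ∀ L F → count (λ v → F (L ∸ v)) (suc L) ≡ count F (suc L)
count-reverse zero    F = refl
count-reverse (suc L) F = begin
  bit (F (suc L)) + count (λ v → F (L ∸ v)) (suc L) ≡⟨ cong (bit (F (suc L)) +_) (count-reverse L F) ⟩
  bit (F (suc L)) + count F (suc L)                 ≡⟨ +-comm (bit (F (suc L))) _ ⟩
  count F (suc L) + bit (F (suc L))                 ≡⟨ count-snoc (suc L) F ⟨
  count F (suc (suc L))                             ∎
  where open ≡-Reasoning

count-single : ∀ {p L} → p < L → count (_≡ᵇ p) L ≡ 1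
count-single {zero}  {suc L} _         = cong suc (count-false L)
count-single {suc p} {suc L} (s≤s p<L) = count-single p<L

count-∪ : ∀ L {F G} → Disjoint L F G → count (F ∪ᵇ G) L ≡ count F L + count G L
count-∪ zero    _       = refl
count-∪ (suc L) {F} {G} F∩G=∅ = begin
  bit (F 0 ∨ G 0) + count ((F ∘ suc) ∪ᵇ (G ∘ suc)) L
    ≡⟨ cong₂ _+_ (bit-∨ (F 0) (G 0) (F∩G=∅ (s≤s z≤n))) (count-∪ L (λ v<L → F∩G=∅ (s≤s v<L))) ⟩
  (bit (F 0) + bit (G 0)) + (count (F ∘ suc) L + count (G ∘ suc) L)
    ≡⟨ interchange (bit (F 0)) (bit (G 0)) _ _ ⟩
  count F (suc L) + count G (suc L) ∎
  where open ≡-Reasoning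

firstN : ℕ → BPred → BPred
firstN i Q v = Q v ∧ (count Q v <ᵇ i)

firstN-⊆ : ∀ i Q → firstN i Q ⊆ᵇ Q
firstN-⊆ i Q = ∩ᵇ-⊆ˡ Q (λ v → count Q v <ᵇ i)

⊓-suc : ∀ i c → i ⊓ c + bit (c <ᵇ i) ≡ i ⊓ suc c
⊓-suc zero    c       = refl
⊓-suc (suc i) zero    = cong suc (sym (⊓-zeroʳ i))
⊓-suc (suc i) (suc c) = cong suc (⊓-suc i c)

count-firstN : ∀ L i Q → count (firstN i Q) L ≡ i ⊓ count Q L
count-firstN zero    i Q = sym (⊓-zeroʳ i)
count-firstN (suc L) i Q = begin
  count (firstN i Q) (suc L)                   ≡⟨ count-snoc L (firstN i Q) ⟩
  count (firstN i Q) L + bit (firstN i Q L)   ≡⟨ cong (_+ bit (firstN i Q L)) (count-firstN L i Q) ⟩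
  i ⊓ count Q L + bit (firstN i Q L)          ≡⟨ step (Q L) ⟩
  i ⊓ (count Q L + bit (Q L))                 ≡⟨ cong (i ⊓_) (count-snoc L Q) ⟨
  i ⊓ count Q (suc L)                          ∎
  where
  open ≡-Reasoning
  c = count Q L
  step : ∀ b → i ⊓ c + bit (b ∧ (c <ᵇ i)) ≡ i ⊓ (c + bit b)
  step false = trans (+-identityʳ _) (cong (i ⊓_) (sym (+-identityʳ c)))
  step true  = trans (⊓-suc i c) (cong (i ⊓_) (+-comm 1 c))

append : ℕ → BPred → BPred → BPred
append zero    F G v       = G v
append (suc a) F G zero    = F 0
append (suc a) F G (suc v) = append a (F ∘ suc) G v

count-append : ∀ a b F G → count (append a F G) (a + b) ≡ count F a + count G b
count-append zero    b F G = refl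
count-append (suc a) b F G =
  trans (cong (bit (F 0) +_) (count-append a b (F ∘ suc) G)) (sym (+-assoc (bit (F 0)) _ _))

append-pathStable : ∀ a {b F G} → PathStable a F → PathStable b G →
                    (∀ {w} → suc w ≡ a → T (F w) → T (G 0) → ⊥) →
                    PathStable (a + b) (append a F G)
append-pathStable zero          F-st G-st junction = G-st
append-pathStable (suc zero)    F-st G-st junction {zero}  _ = junction refl
append-pathStable (suc (suc a)) F-st G-st junction {zero}  _ = F-st (s≤s (s≤s z≤n))
append-pathStable (suc a)       F-st G-st junction {suc v} (s≤s v<a+b) =
  append-pathStable a (λ w<a → F-st (s≤s w<a)) G-st (λ e → junction (cong suc e)) v<a+b

shift-pathStable : ∀ {L F} a {b} → a + b ≤ L → PathStable L F → PathStable b (λ v → F (a + v))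
shift-pathStable {F = F} a {b} a+b≤L F-st {v} v<b Fav Fasv =
  F-st (≤-trans (subst (_≤ a + b) (trans (+-suc a (suc v)) (cong suc (+-suc a v))) (+-monoʳ-≤ a v<b)) a+b≤L)
       Fav (subst (T ∘ F) (+-suc a v) Fasv)

pair-bound : ∀ a b {c t} → (T a → T b → ⊥) → c ≤ t → bit a + (bit b + c) ≤ suc t
pair-bound true  true  a∩b=∅ _   with () ← a∩b=∅ _ _
pair-bound true  false _     c≤t = s≤s c≤t
pair-bound false b     _     c≤t = ≤-trans (+-monoʳ-≤ (bit b) c≤t) (+-monoˡ-≤ _ (bit≤1 b))
  where
  bit≤1 : ∀ b → bit b ≤ 1
  bit≤1 true  = ≤-refl
  bit≤1 false = z≤n

pathStable-count≤half : ∀ t {F} → PathStable (t + t) F → count F (t + t) ≤ t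
pathStable-count≤half zero    _    = z≤n
pathStable-count≤half (suc t) {F} F-st = begin
  count F (suc t + suc t)                                 ≡⟨ cong (count F ∘ suc) (+-suc t t) ⟩
  bit (F 0) + (bit (F 1) + count (F ∘ suc ∘ suc) (t + t))
    ≤⟨ pair-bound (F 0) (F 1) (F-st′ (s≤s (s≤s z≤n))) rest ⟩
  suc t                                                   ∎
  where
  open ≤-Reasoning
  F-st′ : PathStable (suc (suc (t + t))) F
  F-st′ = subst (λ L → PathStable L F) (cong suc (+-suc t t)) F-st
  rest = pathStable-count≤half t (λ v<t+t → F-st′ (s≤s (s≤s v<t+t)))

indicator : ∀ {n} → Subset n → BPred
indicator []      _       = false
indicator (b ∷ p) zero    = b
indicator (b ∷ p) (suc v) = indicator p v

indicator⁻ : ∀ {n} (p : Subset n) {v} → T (indicator p v) → Σ (Fin n) λ x → toℕ x ≡ v × x ∈ p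
indicator⁻ (true  ∷ p) {zero}  _ = fzero , refl , here
indicator⁻ (b     ∷ p) {suc v} t with indicator⁻ p t
... | x , refl , x∈p = fsuc x , refl , there x∈p

count-indicator : ∀ {n} (p : Subset n) → count (indicator p) n ≡ ∣ p ∣
count-indicator []          = refl
count-indicator (true  ∷ p) = cong suc (count-indicator p)
count-indicator (false ∷ p) = count-indicator p

indicator-disjoint : ∀ {n} {p q : Subset n} L → Empty (p ∩ q) → Disjoint L (indicator p) (indicator q)
indicator-disjoint {p = p} {q} _ p∩q=∅ _ pv qv with indicator⁻ p pv | indicator⁻ q qv
... | x , x≡v , x∈p | y , y≡v , y∈q with toℕ-injective (trans x≡v (sym y≡v))
... | refl = p∩q=∅ (x , x∈p∩q⁺ (x∈p , y∈q))

vertex-count : ∀ {m k} (S : SGVertex m k) → count (indicator (proj₁ S)) m ≡ k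
vertex-count (p , ∣p∣≡k , _) = trans (count-indicator p) ∣p∣≡k

vertex-cycleStable : ∀ {m k} (S : SGVertex m k) → CycleStable m (indicator (proj₁ S))
vertex-cycleStable {m} (p , _ , p-st) = path , wrap
  where
  path : PathStable m (indicator p)
  path _ pv psv with indicator⁻ p pv | indicator⁻ p psv
  ... | x , x≡v , x∈p | y , y≡sv , y∈p = p-st x y (inj₁ (trans y≡sv (cong suc (sym x≡v)))) (x∈p , y∈p)
  wrap : ∀ {w} → suc w ≡ m → T (indicator p w) → T (indicator p 0) → ⊥
  wrap sw≡m pw p0 with indicator⁻ p pw | indicator⁻ p p0
  ... | x , x≡w , x∈p | y , y≡0 , y∈p =
    p-st x y (inj₂ (trans x≡w (cong (_∸ 1) sw≡m) , y≡0)) (x∈p , y∈p)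

fromBPred : ∀ n → BPred → Subset n
fromBPred n F = tabulate (F ∘ toℕ)

fromBPred⁻ : ∀ {n} F {x : Fin n} → x ∈ fromBPred n F → T (F (toℕ x))
fromBPred⁻ F {x} x∈ = subst T (sym (trans (sym (lookup∘tabulate (F ∘ toℕ) x)) ([]=⇒lookup x∈))) _

∣fromBPred∣ : ∀ n F → ∣ fromBPred n F ∣ ≡ count F n
∣fromBPred∣ zero    F = refl
∣fromBPred∣ (suc n) F with F 0
... | true  = cong suc (∣fromBPred∣ n (F ∘ suc))
... | false = ∣fromBPred∣ n (F ∘ suc)

fromBPred-disjoint : ∀ {n F G} → Disjoint n F G → Empty (fromBPred n F ∩ fromBPred n G)
fromBPred-disjoint {n} {F} {G} F∩G=∅ (x , x∈) with x∈p∩q⁻ (fromBPred n F) (fromBPred n G) x∈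
... | x∈F , x∈G = F∩G=∅ (toℕ<n x) (fromBPred⁻ F x∈F) (fromBPred⁻ G x∈G)

toℕ≡n∸1⇒1+toℕ≡n : ∀ {n} (x : Fin n) → toℕ x ≡ n ∸ 1 → suc (toℕ x) ≡ n
toℕ≡n∸1⇒1+toℕ≡n {suc n} _ x≡n = cong suc x≡n

toVertex : ∀ {n k} F → count F n ≡ k → CycleStable n F → SGVertex n k
toVertex {n} F count≡k (path , wrap) = fromBPred n F , trans (∣fromBPred∣ n F) count≡k , stable
  where
  stable : CycStable n (fromBPred n F)
  stable x y (inj₁ y≡1+x) (x∈ , y∈) =
    path (subst (_< n) y≡1+x (toℕ<n y)) (fromBPred⁻ F x∈) (subst (T ∘ F) y≡1+x (fromBPred⁻ F y∈))
  stable x y (inj₂ (x≡n∸1 , y≡0)) (x∈ , y∈) =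
    wrap (toℕ≡n∸1⇒1+toℕ≡n x x≡n∸1) (fromBPred⁻ F x∈) (subst (T ∘ F) y≡0 (fromBPred⁻ F y∈))

m∸n≡1+[m∸[1+n]] : ∀ {m n} → n < m → m ∸ n ≡ suc (m ∸ suc n)
m∸n≡1+[m∸[1+n]] {suc m} {zero}  _         = refl
m∸n≡1+[m∸[1+n]] {suc m} {suc n} (s≤s n<m) = m∸n≡1+[m∸[1+n]] n<m

double-mono-< : ∀ {i j m} → i ≤ j → j + j < m → i + i < m
double-mono-< i≤j j+j<m = ≤-<-trans (+-mono-≤ i≤j i≤j) j+j<m

double-pred-< : ∀ {j m} → suc j + suc j < m → j + j < m
double-pred-< = double-mono-< (n≤1+n _)

j+j<m⇒j≤m : ∀ j {m} → j + j < m → j ≤ m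
j+j<m⇒j≤m j j+j<m = ≤-trans (m≤m+n j j) (<⇒≤ j+j<m)

module _ (m : ℕ) where

  window : ℕ → BPred
  window j v = (j ≤ᵇ v) ∧ (v + j <ᵇ m)

  window⁻ : ∀ j v → T (window j v) → j ≤ v × v + j < m
  window⁻ j v t with Equivalence.to (T-∧ {j ≤ᵇ v}) t
  ... | j≤v , v+j<m = ≤ᵇ⇒≤ j v j≤v , <ᵇ⇒< (v + j) m v+j<m

  window⁺ : ∀ {j v} → j ≤ v → v + j < m → T (window j v)
  window⁺ j≤v v+j<m = Equivalence.from T-∧ (≤⇒≤ᵇ j≤v , <⇒<ᵇ v+j<m)

  -- The reflection v ↦ m ∸ v makes border j alternate between the two ends of [0, m] with gaps
  -- of 2, e.g. border 3 = {1, m - 2, m} and border 4 = {0, 2, m - 3, m - 1}.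
  border : ℕ → BPred
  border zero    v = false
  border (suc j) v = (v ≡ᵇ m ∸ j) ∨ border j (m ∸ v)

  border-suc⁻ : ∀ j v → T (border (suc j) v) → v ≡ m ∸ j ⊎ T (border j (m ∸ v))
  border-suc⁻ j v t = map₁ (≡ᵇ⇒≡ v (m ∸ j)) (T-∨⁻ (v ≡ᵇ m ∸ j) t)

  border-location : ∀ {j v} → j ≤ m → T (border j v) → suc v < j ⊎ m < v + j
  border-location {suc j} {v} j<m b with border-suc⁻ j v b
  ... | inj₁ refl = inj₂ (begin-strict
    m                ≡⟨ m∸n+n≡m (<⇒≤ j<m) ⟨
    (m ∸ j) + j      <⟨ n<1+n _ ⟩
    suc (m ∸ j + j)  ≡⟨ +-suc (m ∸ j) j ⟨
    (m ∸ j) + suc j  ∎)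
    where open ≤-Reasoning
  ... | inj₂ b′ with border-location (<⇒≤ j<m) b′
  ...   | inj₁ 1+m∸v<j = inj₂ (begin-strict
    m            ≤⟨ m≤n+m∸n m v ⟩
    v + (m ∸ v)  <⟨ +-monoʳ-< v (<⇒≤ 1+m∸v<j) ⟩
    v + j        <⟨ +-monoʳ-< v (n<1+n j) ⟩
    v + suc j    ∎)
    where open ≤-Reasoning
  ...   | inj₂ m<m∸v+j = inj₁ (s≤s (≰⇒> λ j≤v → <⇒≱ m<m∸v+j (begin
    (m ∸ v) + j  ≤⟨ +-monoˡ-≤ j (∸-monoʳ-≤ m j≤v) ⟩
    (m ∸ j) + j  ≡⟨ m∸n+n≡m (<⇒≤ j<m) ⟩
    m            ∎)))
    where open ≤-Reasoning

  module _ (j : ℕ) (j+j<m : j + j < m) where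

    private
      j≤m : j ≤ m
      j≤m = j+j<m⇒j≤m j j+j<m

    j∉border : T (border j j) → ⊥
    j∉border b with border-location j≤m b
    ... | inj₁ 1+j<j = n≮n j (<-trans (n<1+n j) 1+j<j)
    ... | inj₂ m<j+j = <-asym m<j+j j+j<m

    suc∉border : T (border j (suc j)) → ⊥
    suc∉border b with border-location j≤m b
    ... | inj₁ 2+j<j = n≮n j (<-trans (m<n⇒m<1+n (n<1+n j)) 2+j<j)
    ... | inj₂ m<1+j+j = ≤⇒≯ j+j<m m<1+j+j

    m∸j∉border : T (border j (m ∸ j)) → ⊥
    m∸j∉border b with border-location j≤m b
    ... | inj₁ 1+m∸j<j = <-asym j+j<m (subst (_< j + j) (m∸n+n≡m j≤m) (+-monoˡ-< j (<⇒≤ 1+m∸j<j)))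
    ... | inj₂ m<m∸j+j = n≮n m (subst (m <_) (m∸n+n≡m j≤m) m<m∸j+j)

    m∸[m∸j]≡j : m ∸ (m ∸ j) ≡ j
    m∸[m∸j]≡j = m∸[m∸n]≡n j≤m

  pred∉border : ∀ j → j + j < m → T (border j (pred j)) → ⊥
  pred∉border (suc j) 1+j+1+j<m b with border-location (j+j<m⇒j≤m (suc j) 1+j+1+j<m) b
  ... | inj₁ 1+j<1+j = n≮n (suc j) 1+j<1+j
  ... | inj₂ m<j+1+j = <-asym m<j+1+j (<-trans (n<1+n _) 1+j+1+j<m)

  border-reflect-disjoint : ∀ j {v} → j + j < m → v ≤ m → T (border j v) → T (border j (m ∸ v)) → ⊥
  border-reflect-disjoint (suc j) {v} 1+j+1+j<m v≤m b b′ with border-suc⁻ j v b | border-suc⁻ j (m ∸ v) b′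
  ... | inj₁ refl | inj₁ m∸[m∸j]≡m∸j = <-irrefl j+j≡m j+j<m
    where
    j+j<m = double-pred-< 1+j+1+j<m
    j+j≡m = trans (cong (_+ j) (trans (sym (m∸[m∸j]≡j j j+j<m)) m∸[m∸j]≡m∸j))
                  (m∸n+n≡m (j+j<m⇒j≤m j j+j<m))
  ... | inj₁ refl | inj₂ b″ =
    m∸j∉border j (double-pred-< 1+j+1+j<m) (subst (T ∘ border j) (m∸[m∸n]≡n (m∸n≤m m j)) b″)
  ... | inj₂ b″   | inj₁ m∸v≡m∸j =
    m∸j∉border j (double-pred-< 1+j+1+j<m) (subst (T ∘ border j) m∸v≡m∸j b″)
  ... | inj₂ b₁   | inj₂ b₂ = border-reflect-disjoint j (double-pred-< 1+j+1+j<m) (m∸n≤m m v) b₁ b₂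

  border-pathStable : ∀ j → j + j < m → PathStable (suc m) (border j)
  border-pathStable (suc j) 1+j+1+j<m {v} (s≤s v<m) b bs with border-suc⁻ j v b | border-suc⁻ j (suc v) bs
  ... | inj₁ v≡m∸j | inj₁ 1+v≡m∸j = <-irrefl (trans v≡m∸j (sym 1+v≡m∸j)) (n<1+n v)
  ... | inj₁ refl  | inj₂ b′ = pred∉border j j+j<m (subst (T ∘ border j) m∸[1+[m∸j]]≡pred-j b′)
    where
    j+j<m = double-pred-< 1+j+1+j<m
    m∸[1+[m∸j]]≡pred-j : m ∸ suc (m ∸ j) ≡ pred j
    m∸[1+[m∸j]]≡pred-j = trans (sym (pred[m∸n]≡m∸[1+n] m (m ∸ j))) (cong pred (m∸[m∸j]≡j j j+j<m))
  ... | inj₂ b′ | inj₁ 1+v≡m∸j = suc∉border j j+j<m (subst (T ∘ border j) m∸v≡1+j b′)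
    where
    j+j<m = double-pred-< 1+j+1+j<m
    m∸v≡1+j : m ∸ v ≡ suc j
    m∸v≡1+j = begin
      m ∸ v              ≡⟨ m∸n≡1+[m∸[1+n]] v<m ⟩
      suc (m ∸ suc v)    ≡⟨ cong (suc ∘ (m ∸_)) 1+v≡m∸j ⟩
      suc (m ∸ (m ∸ j))  ≡⟨ cong suc (m∸[m∸j]≡j j j+j<m) ⟩
      suc j              ∎
      where open ≡-Reasoning
  ... | inj₂ b₁ | inj₂ b₂ =
    border-pathStable j (double-pred-< 1+j+1+j<m)
      (s≤s (subst (_≤ m) m∸v≡1+[m∸[1+v]] (m∸n≤m m v)))
      b₂ (subst (T ∘ border j) m∸v≡1+[m∸[1+v]] b₁)
    where
    m∸v≡1+[m∸[1+v]] = m∸n≡1+[m∸[1+n]] v<m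

  border-wrap : ∀ j → j + j < m → T (border j m) → T (border j 0) → ⊥
  border-wrap j j+j<m bm b0 = border-reflect-disjoint j j+j<m z≤n b0 bm

  count-border : ∀ j → j + j < m → count (border j) (suc m) ≡ j
  count-border zero    _ = count-false (suc m)
  count-border (suc j) 1+j+1+j<m = begin
    count (border (suc j)) (suc m)
      ≡⟨ count-∪ (suc m) {_≡ᵇ m ∸ j} {border j ∘ (m ∸_)} apex-∉-reflection ⟩
    count (_≡ᵇ m ∸ j) (suc m) + count (border j ∘ (m ∸_)) (suc m)
      ≡⟨ cong₂ _+_ (count-single (s≤s (m∸n≤m m j))) (count-reverse m (border j)) ⟩
    suc (count (border j) (suc m))
      ≡⟨ cong suc (count-border j j+j<m) ⟩
    suc j ∎
    where
    open ≡-Reasoning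
    j+j<m = double-pred-< 1+j+1+j<m
    apex-∉-reflection : Disjoint (suc m) (_≡ᵇ m ∸ j) (border j ∘ (m ∸_))
    apex-∉-reflection {v} _ v≡m∸j b with ≡ᵇ⇒≡ v (m ∸ j) v≡m∸j
    ... | refl = j∉border j j+j<m (subst (T ∘ border j) (m∸[m∸j]≡j j j+j<m) b)

  border-disjoint-suc : ∀ j → j + j < m → Disjoint (suc m) (border j) (border (suc j))
  border-disjoint-suc j j+j<m {v} (s≤s v≤m) b b′ with border-suc⁻ j v b′
  ... | inj₁ refl = m∸j∉border j j+j<m b
  ... | inj₂ b″   = border-reflect-disjoint j j+j<m v≤m b b″

  border-∉-window : ∀ {j j′} v → j ≤ suc j′ → T (border j v) → T (window j′ v) → ⊥
  border-∉-window {j} {j′} v j≤1+j′ b w with window⁻ j′ v w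
  ... | j′≤v , v+j′<m with border-location (≤-trans j≤1+j′ (≤-trans (s≤s (m≤n+m j′ v)) v+j′<m)) b
  ...   | inj₁ 1+v<j = <⇒≱ (≤-pred (≤-trans 1+v<j j≤1+j′)) j′≤v
  ...   | inj₂ m<v+j =
    <⇒≱ m<v+j (≤-trans (+-monoʳ-≤ v j≤1+j′) (subst (_≤ m) (sym (+-suc v j′)) v+j′<m))

  border⇒0<j : ∀ j {v} → T (border j v) → 0 < j
  border⇒0<j (suc j) _ = s≤s z≤n

  border-∉-window-suc : ∀ j v → T (window j v) → T (border j (suc v)) → ⊥
  border-∉-window-suc j v w b with window⁻ j v w
  ... | j≤v , v+j<m with border-location (≤-trans (m≤n+m j v) (<⇒≤ v+j<m)) b
  ...   | inj₁ 2+v<j     = <⇒≱ (<-trans (m<n⇒m<1+n (n<1+n v)) 2+v<j) j≤v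
  ...   | inj₂ m<1+v+j   = ≤⇒≯ v+j<m m<1+v+j

  border-∉-window-pred : ∀ j v → T (window j (suc v)) → T (border j v) → ⊥
  border-∉-window-pred j v w b with window⁻ j (suc v) w
  ... | j≤1+v , 1+v+j<m with border-location (≤-trans (m≤n+m j (suc v)) (<⇒≤ 1+v+j<m)) b
  ...   | inj₁ 1+v<j = <⇒≱ 1+v<j j≤1+v
  ...   | inj₂ m<v+j = <-asym m<v+j (<-trans (n<1+n _) 1+v+j<m)

  module _ (A : BPred) (j : ℕ) (j+j<m : j + j < m) (A⊆window : A ⊆ᵇ window j) where

    layer-count : count (A ∪ᵇ border j) (suc m) ≡ count A (suc m) + j
    layer-count = trans (count-∪ (suc m) λ {v} _ a b → border-∉-window v (n≤1+n j) b (A⊆window a))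
                        (cong (count A (suc m) +_) (count-border j j+j<m))

    layer-cycleStable : PathStable (suc m) A → CycleStable (suc m) (A ∪ᵇ border j)
    layer-cycleStable A-st = path , λ 1+w≡1+m → wrap (suc-injective 1+w≡1+m)
      where
      path : PathStable (suc m) (A ∪ᵇ border j)
      path {v} 1+v<1+m x y with T-∨⁻ (A v) x | T-∨⁻ (A (suc v)) y
      ... | inj₁ a | inj₁ a′ = A-st 1+v<1+m a a′
      ... | inj₁ a | inj₂ b′ = border-∉-window-suc j v (A⊆window a) b′
      ... | inj₂ b | inj₁ a′ = border-∉-window-pred j v (A⊆window a′) b
      ... | inj₂ b | inj₂ b′ = border-pathStable j j+j<m 1+v<1+m b b′
      wrap : ∀ {w} → w ≡ m → T ((A ∪ᵇ border j) w) → T ((A ∪ᵇ border j) 0) → ⊥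
      wrap refl x y with T-∨⁻ (A m) x | T-∨⁻ (A 0) y
      ... | inj₁ a | _      = m+n≮m m j (proj₂ (window⁻ j m (A⊆window a)))
      ... | inj₂ b | inj₁ a  = <⇒≱ (border⇒0<j j b) (proj₁ (window⁻ j 0 (A⊆window a)))
      ... | inj₂ b | inj₂ b′ = border-wrap j j+j<m b b′

    layer-disjoint : ∀ A′ {j′} → j′ ≡ suc j → A′ ⊆ᵇ window j′ → Disjoint (suc m) A A′ →
                     Disjoint (suc m) (A ∪ᵇ border j) (A′ ∪ᵇ border j′)
    layer-disjoint A′ refl A′⊆window A∩A′=∅ {v} v≤m x y with T-∨⁻ (A v) x | T-∨⁻ (A′ v) y
    ... | inj₁ a | inj₁ a′ = A∩A′=∅ v≤m a a′
    ... | inj₁ a | inj₂ b′ = border-∉-window v ≤-refl b′ (A⊆window a)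
    ... | inj₂ b | inj₁ a′ = border-∉-window v (m≤n⇒m≤1+n (n≤1+n j)) b (A′⊆window a′)
    ... | inj₂ b | inj₂ b′ = border-disjoint-suc j j+j<m v≤m b b′

  layer₀-disjoint : ∀ {L A A′ j j′} → j ≡ 0 → j′ ≡ 0 → Disjoint L A A′ →
                    Disjoint L (A ∪ᵇ border j) (A′ ∪ᵇ border j′)
  layer₀-disjoint {A = A} {A′} refl refl A∩A′=∅ {v} v<L x y with T-∨⁻ (A v) x | T-∨⁻ (A′ v) y
  ... | inj₁ a | inj₁ a′ = A∩A′=∅ v<L a a′

-- The 2j positions outside the window form a path through the wrap-around edge, so a cyclically
-- stable set has at most j of them.
window-count-bound : ∀ j mid {P} → let m = j + mid + j in
                     CycleStable m P → count P m ≤ count (P ∩ᵇ window m j) m + j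
window-count-bound j mid {P} (P-path , P-wrap) = begin
  count P (j + mid + j)  ≡⟨ count-+ (j + mid) j P ⟩
  count P (j + mid) + R  ≡⟨ cong (_+ R) (count-+ j mid P) ⟩
  (L + M) + R            ≡⟨ xy∙z≈y∙zx L M R ⟩
  M + (R + L)            ≤⟨ +-monoʳ-≤ M outside ⟩
  M + j                  ≤⟨ +-monoˡ-≤ j inside ⟩
  count Q m + j          ∎
  where
  open ≤-Reasoning
  m = j + mid + j
  Q = P ∩ᵇ window m j
  L = count P j
  M = count (λ v → P (j + v)) mid
  R = count (λ v → P (j + mid + v)) j
  junction : ∀ {w} → suc w ≡ j → T (P (j + mid + w)) → T (P 0) → ⊥
  junction {w} 1+w≡j = P-wrap (trans (sym (+-suc (j + mid) w)) (cong (j + mid +_) 1+w≡j))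
  outside : R + L ≤ j
  outside = subst (_≤ j) (count-append j j _ P)
    (pathStable-count≤half j
      (append-pathStable j (shift-pathStable (j + mid) ≤-refl P-path)
                           (shift-pathStable 0 (m≤n+m j (j + mid)) P-path) junction))
  middle-in-window : ∀ {v} → v < mid → T (P (j + v)) → T (Q (j + v))
  middle-in-window v<mid Pj+v =
    Equivalence.from T-∧ (Pj+v , window⁺ m (m≤m+n j _) (+-monoˡ-< j (+-monoʳ-< j v<mid)))
  inside : M ≤ count Q m
  inside = begin
    M                                        ≤⟨ count-mono mid middle-in-window ⟩
    count (λ v → Q (j + v)) mid              ≤⟨ m≤n+m _ (count Q j) ⟩
    count Q j + count (λ v → Q (j + v)) mid  ≡⟨ count-+ j mid Q ⟨
    count Q (j + mid)                        ≤⟨ count-mono-length Q (m≤m+n (j + mid) j) ⟩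
    count Q m                                ∎

count≤count[∩window]+j : ∀ {m} j {P} → j + j ≤ m → CycleStable m P →
                         count P m ≤ count (P ∩ᵇ window m j) m + j
count≤count[∩window]+j j {P} j+j≤m with m≤n⇒∃[o]m+o≡n j+j≤m
... | mid , refl = subst (λ m → CycleStable m P → count P m ≤ count (P ∩ᵇ window m j) m + j)
                         (trans (xy∙z≈x∙zy j mid j) (sym (+-assoc j j mid)))
                         (window-count-bound j mid)

depth : ∀ {k} → Fin k → ℕ
depth {k} l = k ∸ suc (toℕ l)

size+depth : ∀ {k} (l : Fin k) → suc (toℕ l) + depth l ≡ k
size+depth l = m+[n∸m]≡n (toℕ<n l)

k∸toℕ≡1+depth : ∀ {k t} (l : Fin k) → toℕ l ≡ t → k ∸ t ≡ suc (depth l)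
k∸toℕ≡1+depth l refl = m∸n≡1+[m∸[1+n]] (toℕ<n l)

depth-top : ∀ {k} (l : Fin k) → toℕ l ≡ k ∸ 1 → depth l ≡ 0
depth-top {k} l l≡k∸1 = m≤n⇒m∸n≡0 (subst (λ t → k ≤ suc t) (sym l≡k∸1) (m≤n+m∸n k 1))

module _ {m k : ℕ} (k+k<m : k + k < m) where

  private
    depth+depth<m : (l : Fin k) → depth l + depth l < m
    depth+depth<m l = double-mono-< (m∸n≤m k (suc (toℕ l))) k+k<m

  windowed : SGVertex m k → Fin k → BPred
  windowed S l = indicator (proj₁ S) ∩ᵇ window m (depth l)

  core : SGVertex m k → Fin k → BPred
  core S l = firstN (suc (toℕ l)) (windowed S l)

  core⊆window : ∀ S l → core S l ⊆ᵇ window m (depth l)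
  core⊆window S l c =
    ∩ᵇ-⊆ʳ (indicator (proj₁ S)) (window m (depth l)) (firstN-⊆ (suc (toℕ l)) (windowed S l) c)

  core⊆S : ∀ S l → core S l ⊆ᵇ indicator (proj₁ S)
  core⊆S S l c =
    ∩ᵇ-⊆ˡ (indicator (proj₁ S)) (window m (depth l)) (firstN-⊆ (suc (toℕ l)) (windowed S l) c)

  core-pathStable : ∀ S l → PathStable (suc m) (core S l)
  core-pathStable S l {v} _ c c′ = proj₁ (vertex-cycleStable S) 1+v<m (core⊆S S l c) (core⊆S S l c′)
    where
    1+v<m : suc v < m
    1+v<m = ≤-<-trans (m≤m+n (suc v) _) (proj₂ (window⁻ m (depth l) (suc v) (core⊆window S l c′)))

  core-count : ∀ S l → count (core S l) (suc m) ≡ suc (toℕ l)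
  core-count S l = trans (count-firstN (suc m) (suc (toℕ l)) Q) (m≤n⇒m⊓n≡m size≤count)
    where
    Q = windowed S l
    size+depth≤ : suc (toℕ l) + depth l ≤ count Q m + depth l
    size+depth≤ = subst (_≤ count Q m + depth l) (trans (vertex-count S) (sym (size+depth l)))
                    (count≤count[∩window]+j (depth l) (<⇒≤ (depth+depth<m l)) (vertex-cycleStable S))
    size≤count : suc (toℕ l) ≤ count Q (suc m)
    size≤count = ≤-trans (+-cancelʳ-≤ (depth l) _ _ size+depth≤) (count-mono-length Q (n≤1+n m))

  core-disjoint : ∀ S S′ l l′ → Empty (proj₁ S ∩ proj₁ S′) →
                  Disjoint (suc m) (core S l) (core S′ l′)
  core-disjoint S S′ l l′ S∩S′=∅ =
    Disjoint-mono (core⊆S S l) (core⊆S S′ l′) (indicator-disjoint (suc m) S∩S′=∅)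

  image : MVert (SGVertex m k) k → BPred
  image apex        = ∅ᵇ ∪ᵇ border m k
  image (layer S l) = core S l ∪ᵇ border m (depth l)

  image-count : ∀ u → count (image u) (suc m) ≡ k
  image-count apex        = trans (layer-count m ∅ᵇ k k+k<m λ ()) (cong (_+ k) (count-false (suc m)))
  image-count (layer S l) = begin
    count (image (layer S l)) (suc m)
      ≡⟨ layer-count m (core S l) (depth l) (depth+depth<m l) (core⊆window S l) ⟩
    count (core S l) (suc m) + depth l
      ≡⟨ cong (_+ depth l) (core-count S l) ⟩
    suc (toℕ l) + depth l
      ≡⟨ size+depth l ⟩
    k ∎
    where open ≡-Reasoning

  image-cycleStable : ∀ u → CycleStable (suc m) (image u)
  image-cycleStable apex        = layer-cycleStable m ∅ᵇ k k+k<m (λ ()) λ _ ()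
  image-cycleStable (layer S l) =
    layer-cycleStable m (core S l) (depth l) (depth+depth<m l) (core⊆window S l) (core-pathStable S l)

  image-disjoint-deeper : ∀ S l A′ {j′} → j′ ≡ suc (depth l) → A′ ⊆ᵇ window m j′ →
                          Disjoint (suc m) (core S l) A′ →
                          Disjoint (suc m) (image (layer S l)) (A′ ∪ᵇ border m j′)
  image-disjoint-deeper S l = layer-disjoint m (core S l) (depth l) (depth+depth<m l) (core⊆window S l)

  image-disjoint : ∀ {u w} → MAdj (SG m k) k u w → Disjoint (suc m) (image u) (image w)
  image-disjoint (up S S′ l l′ S∩S′=∅ l≡1+l′) =
    image-disjoint-deeper S l (core S′ l′) (k∸toℕ≡1+depth l l≡1+l′) (core⊆window S′ l′)
      (core-disjoint S S′ l l′ S∩S′=∅)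
  image-disjoint (down S S′ l l′ S∩S′=∅ l′≡1+l) = Disjoint-sym
    (image-disjoint-deeper S′ l′ (core S l) (k∸toℕ≡1+depth l′ l′≡1+l) (core⊆window S l)
      (Disjoint-sym (core-disjoint S S′ l l′ S∩S′=∅)))
  image-disjoint (top S S′ l l′ S∩S′=∅ l≡k∸1 l′≡k∸1) =
    layer₀-disjoint m (depth-top l l≡k∸1) (depth-top l′ l′≡k∸1) (core-disjoint S S′ l l′ S∩S′=∅)
  image-disjoint (apexˡ S l l≡0) =
    Disjoint-sym (image-disjoint-deeper S l ∅ᵇ (k∸toℕ≡1+depth l l≡0) (λ ()) λ _ _ ())
  image-disjoint (apexʳ S l l≡0) = image-disjoint-deeper S l ∅ᵇ (k∸toℕ≡1+depth l l≡0) (λ ()) λ _ _ ()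

  mycielskian-hom : Hom (Myc k (SG m k)) (SG (suc m) k)
  mycielskian-hom = (λ u → toVertex (image u) (image-count u) (image-cycleStable u))
                  , λ _ _ u~w → fromBPred-disjoint (image-disjoint u~w)

lemma6p2 : (k n : ℕ) → 1 ≤ k → 2 * k + 1 < n → Hom (Myc k (SG (n ∸ 1) k)) (SG n k)
lemma6p2 k (suc m) _ 2k+1<1+m = mycielskian-hom (subst (_≤ m) 2k+1≡1+k+k (≤-pred 2k+1<1+m))
  where
  2k+1≡1+k+k : 2 * k + 1 ≡ suc (k + k)
  2k+1≡1+k+k = trans (+-comm (2 * k) 1) (cong (λ t → suc (k + t)) (+-identityʳ k))
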